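{- For every $n\in\mathbb{N}$, \[ \sum_{k=1}^{n}\frac{(-1)^{k-1}}{k}\binom{n}{k}\left[H_{n-k}^2+H_{n-k}^{(2)}\right]=H_n^3+H_nH_n^{(2)}+2\sum_{k=1}^{n}\frac{(-1)^k[H_n-H_{k-1}]}{k^2\binom{n}{k}}. \]
   Context: For $m\in\mathbb{N}_0$, $H_m^{(r)}=\sum_{j=1}^{m}\frac{1}{j^r}$ (with $H_0^{(r)}=0$) and $H_m=H_m^{(1)}$. -}

module Defs where

open import Data.Nat as ℕ using (ℕ; zero; suc; _∸_)
open import Data.Nat.Combinatorics using (_C_)
open import Data.Integer as ℤ using (ℤ; +_)
open import Data.Rational using (ℚ; 0ℚ; _+_; _*_; _-_; -_; _/_; 1/_)
open import Data.Nat.Properties using (m^n≢0)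

sum1 : ℕ → (ℕ → ℚ) → ℚ
sum1 zero    f = 0ℚ
sum1 (suc n) f = sum1 n f + f (suc n)

sgn : ℕ → ℚ
sgn zero    = + 1 / 1
sgn (suc m) = - sgn m

invPowSuc : ℕ → ℕ → ℚ
invPowSuc r j = _/_ (+ 1) (suc j ℕ.^ r) {{m^n≢0 (suc j) r}}

H^ : ℕ → ℕ → ℚ
H^ r m = sum1 m (λ j → invPowSuc r (j ∸ 1))

H : ℕ → ℚ
H = H^ 1

binomℚ : ℕ → ℕ → ℚ
binomℚ n k = + (n C k) / 1

-- 1 / (k^2 * C(n,k)), with the (paper-irrelevant) value 0 if the
-- denominator vanishes (never happens for 1 ≤ k ≤ n, where it is used)
invK2Binom : ℕ → ℕ → ℚ
invK2Binom n k with k ℕ.* k ℕ.* (n C k)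
... | zero  = 0ℚ
... | suc d = + 1 / suc d

-- Let T f n = Σ_{k=1}^n (-1)^(k-1) C(n,k) f(n-k) / k, so that the left-hand side is T (H² + H^(2)) n,
-- and let Δ f n = Σ_{k=0}^n (-1)^k C(n,k) f(n-k). Pascal's rule and the absorption identities for
-- C(n,k) give T f (n+1) = T (f ∘ suc) n + (f(n+1) - Δ f (n+1))/(n+1) and Δ f (n+1) = Δ (f ∘ suc) n - Δ f n,
-- and express T and Δ of m ↦ g(m+1)/(m+1) through T g (n+1) and Δ g (n+1). Hence T 1 = H,
-- Δ H (n+1) = (-1)^n/(n+1), T H n = H_n² + V 1 n where V w n = Σ_{k=1}^n (-1)^k w(k) / (k² C(n,k)), and
-- T (H² + H^(2)) satisfies a first-order recurrence in n. The sums V 1 and V (H ∘ pred) satisfy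
-- first-order recurrences as well, obtained from 1/C(m,j) = (m+1)/(m+2) (1/C(m+1,j) + 1/C(m+1,j+1)) and
-- summation by parts. So both sides of the identity satisfy the same recurrence and agree at n = 0.

module Submission where

open import Data.Nat as ℕ using (ℕ; zero; suc; _∸_; z≤n; s≤s)
import Data.Nat.Properties as ℕₚ
open import Data.Nat.Combinatorics using (_C_; nCk+nC[k+1]≡[n+1]C[k+1]; k>n⇒nCk≡0; nCn≡1; nC1≡n)
open import Data.Nat.Coprimality using (1-coprimeTo) renaming (sym to coprime-sym)
open import Data.Integer as ℤ using (+_)
import Data.Integer.Properties as ℤₚ
open import Data.Rational using (ℚ; mkℚ; 0ℚ; 1ℚ; _+_; _*_; _-_; -_; _/_)
open import Data.Rational.Properties
  using ( +-*-commutativeRing; _≟_; normalize-coprime; /-cong; *-inverseˡ; *-identityˡ; *-identityʳ; *-zeroˡ; *-zeroʳ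
        ; *-distribˡ-+; neg-distrib-+; +-comm; +-assoc; +-identityʳ; +-inverseʳ; *-comm; *-assoc)
open import Data.Maybe using (Maybe; just; nothing)
open import Relation.Nullary using (yes; no)
open import Relation.Binary.PropositionalEquality
open import Tactic.RingSolver using (solve-∀)
open import Data.Nat.Tactic.RingSolver using () renaming (solve-∀ to ℕ-solve-∀)
open import Tactic.RingSolver.Core.AlmostCommutativeRing using (AlmostCommutativeRing; fromCommutativeRing)

open import Defs

open ≡-Reasoning

ℚ-ring : AlmostCommutativeRing _ _
ℚ-ring = fromCommutativeRing +-*-commutativeRing isZero
  where
  isZero : ∀ x → Maybe (0ℚ ≡ x)
  isZero x with 0ℚ ≟ x
  ... | yes p = just p
  ... | no _  = nothing

-- Natural numbers and their reciprocals in ℚ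

⟦_⟧ : ℕ → ℚ
⟦ n ⟧ = + n / 1

⟦⟧≡mkℚ : ∀ n → ⟦ n ⟧ ≡ mkℚ (+ n) 0 (coprime-sym (1-coprimeTo n))
⟦⟧≡mkℚ n = normalize-coprime _

⟦⟧-+ : ∀ m n → ⟦ m ℕ.+ n ⟧ ≡ ⟦ m ⟧ + ⟦ n ⟧
⟦⟧-+ m n = begin
  ⟦ m ℕ.+ n ⟧
    ≡⟨ /-cong (trans (ℤₚ.pos-+ m n) (sym (cong₂ ℤ._+_ (ℤₚ.*-identityʳ (+ m)) (ℤₚ.*-identityʳ (+ n))))) refl ⟩
  (+ m ℤ.* + 1 ℤ.+ + n ℤ.* + 1) / 1  ≡⟨ cong₂ _+_ (⟦⟧≡mkℚ m) (⟦⟧≡mkℚ n) ⟨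
  ⟦ m ⟧ + ⟦ n ⟧                      ∎

⟦⟧-* : ∀ m n → ⟦ m ℕ.* n ⟧ ≡ ⟦ m ⟧ * ⟦ n ⟧
⟦⟧-* m n = begin
  ⟦ m ℕ.* n ⟧         ≡⟨ /-cong (ℤₚ.pos-* m n) refl ⟩
  (+ m ℤ.* + n) / 1   ≡⟨ cong₂ _*_ (⟦⟧≡mkℚ m) (⟦⟧≡mkℚ n) ⟨
  ⟦ m ⟧ * ⟦ n ⟧       ∎

-- The reciprocal of a natural number, with junk value recip 0 = 0.
recip : ℕ → ℚ
recip zero    = 0ℚ
recip (suc n) = + 1 / suc n

recip-inverse : ∀ n .{{_ : ℕ.NonZero n}} → recip n * ⟦ n ⟧ ≡ 1ℚ
recip-inverse (suc n) = trans (cong₂ _*_ (normalize-coprime {1} {n} (1-coprimeTo _)) (⟦⟧≡mkℚ (suc n)))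
                              (*-inverseˡ (mkℚ (+ suc n) 0 (coprime-sym (1-coprimeTo (suc n)))))

recip-unique : ∀ n .{{_ : ℕ.NonZero n}} y → y * ⟦ n ⟧ ≡ 1ℚ → recip n ≡ y
recip-unique n y y*n≡1 = begin
  recip n                     ≡⟨ *-identityʳ (recip n) ⟨
  recip n * 1ℚ                ≡⟨ cong (recip n *_) y*n≡1 ⟨
  recip n * (y * ⟦ n ⟧)       ≡⟨ rearrange (recip n) y ⟦ n ⟧ ⟩
  y * (recip n * ⟦ n ⟧)       ≡⟨ cong (y *_) (recip-inverse n) ⟩
  y * 1ℚ                      ≡⟨ *-identityʳ y ⟩
  y                           ∎
  where
  rearrange : ∀ (a b c : ℚ) → a * (b * c) ≡ b * (a * c)
  rearrange = solve-∀ ℚ-ring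

recip-* : ∀ m n → recip (m ℕ.* n) ≡ recip m * recip n
recip-* zero    n       = sym (*-zeroˡ (recip n))
recip-* (suc m) zero    = trans (cong recip (ℕₚ.*-zeroʳ m)) (sym (*-zeroʳ (recip (suc m))))
recip-* (suc m) (suc n) = recip-unique (suc m ℕ.* suc n) (recip (suc m) * recip (suc n)) (begin
  recip (suc m) * recip (suc n) * ⟦ suc m ℕ.* suc n ⟧           ≡⟨ cong (recip (suc m) * recip (suc n) *_) (⟦⟧-* (suc m) (suc n)) ⟩
  recip (suc m) * recip (suc n) * (⟦ suc m ⟧ * ⟦ suc n ⟧)       ≡⟨ interchange (recip (suc m)) (recip (suc n)) ⟦ suc m ⟧ ⟦ suc n ⟧ ⟩
  (recip (suc m) * ⟦ suc m ⟧) * (recip (suc n) * ⟦ suc n ⟧)     ≡⟨ cong₂ _*_ (recip-inverse (suc m)) (recip-inverse (suc n)) ⟩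
  1ℚ * 1ℚ                                                       ≡⟨ *-identityˡ 1ℚ ⟩
  1ℚ                                                            ∎)
  where
  interchange : ∀ (a b c d : ℚ) → a * b * (c * d) ≡ (a * c) * (b * d)
  interchange = solve-∀ ℚ-ring

recip-cancelˡ : ∀ a b .{{_ : ℕ.NonZero a}} → ⟦ a ⟧ * recip (a ℕ.* b) ≡ recip b
recip-cancelˡ a b = begin
  ⟦ a ⟧ * recip (a ℕ.* b)       ≡⟨ cong (⟦ a ⟧ *_) (recip-* a b) ⟩
  ⟦ a ⟧ * (recip a * recip b)   ≡⟨ rearrange ⟦ a ⟧ (recip a) (recip b) ⟩
  (recip a * ⟦ a ⟧) * recip b   ≡⟨ cong (_* recip b) (recip-inverse a) ⟩
  1ℚ * recip b                  ≡⟨ *-identityˡ (recip b) ⟩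
  recip b                       ∎
  where
  rearrange : ∀ (a b c : ℚ) → a * (b * c) ≡ (b * a) * c
  rearrange = solve-∀ ℚ-ring

recip-from-* : ∀ {a b c d} .{{_ : ℕ.NonZero a}} → a ℕ.* b ≡ c ℕ.* d → recip b ≡ ⟦ a ⟧ * recip c * recip d
recip-from-* {a} {b} {c} {d} ab≡cd = begin
  recip b                       ≡⟨ recip-cancelˡ a b ⟨
  ⟦ a ⟧ * recip (a ℕ.* b)       ≡⟨ cong (λ x → ⟦ a ⟧ * recip x) ab≡cd ⟩
  ⟦ a ⟧ * recip (c ℕ.* d)       ≡⟨ cong (⟦ a ⟧ *_) (recip-* c d) ⟩
  ⟦ a ⟧ * (recip c * recip d)   ≡⟨ assoc ⟦ a ⟧ (recip c) (recip d) ⟩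
  ⟦ a ⟧ * recip c * recip d     ∎
  where
  assoc : ∀ (x y z : ℚ) → x * (y * z) ≡ x * y * z
  assoc = solve-∀ ℚ-ring

⟦⟧-recip-from-* : ∀ {a b c d} .{{_ : ℕ.NonZero a}} .{{_ : ℕ.NonZero c}} →
                  a ℕ.* b ≡ c ℕ.* d → ⟦ b ⟧ * recip c ≡ ⟦ d ⟧ * recip a
⟦⟧-recip-from-* {a} {b} {c} {d} ab≡cd = begin
  ⟦ b ⟧ * recip c                       ≡⟨ cong (⟦ b ⟧ *_) (recip-cancelˡ a c) ⟨
  ⟦ b ⟧ * (⟦ a ⟧ * recip (a ℕ.* c))     ≡⟨ swap ⟦ b ⟧ ⟦ a ⟧ _ ⟩
  ⟦ a ⟧ * ⟦ b ⟧ * recip (a ℕ.* c)       ≡⟨ cong (_* recip (a ℕ.* c)) (⟦⟧-* a b) ⟨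
  ⟦ a ℕ.* b ⟧ * recip (a ℕ.* c)         ≡⟨ cong₂ (λ x y → ⟦ x ⟧ * recip y) ab≡cd (ℕₚ.*-comm a c) ⟩
  ⟦ c ℕ.* d ⟧ * recip (c ℕ.* a)         ≡⟨ cong (_* recip (c ℕ.* a)) (⟦⟧-* c d) ⟩
  ⟦ c ⟧ * ⟦ d ⟧ * recip (c ℕ.* a)       ≡⟨ swap ⟦ d ⟧ ⟦ c ⟧ _ ⟨
  ⟦ d ⟧ * (⟦ c ⟧ * recip (c ℕ.* a))     ≡⟨ cong (⟦ d ⟧ *_) (recip-cancelˡ c a) ⟩
  ⟦ d ⟧ * recip a                       ∎
  where
  swap : ∀ (x y z : ℚ) → x * (y * z) ≡ y * x * z
  swap = solve-∀ ℚ-ring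

-- Binomial coefficients

pascal : ∀ n k → suc n C suc k ≡ n C k ℕ.+ n C suc k
pascal n k = sym (nCk+nC[k+1]≡[n+1]C[k+1] n k)

[1+k]*[1+n]C[1+k]≡[1+n]*nCk : ∀ n k → suc k ℕ.* (suc n C suc k) ≡ suc n ℕ.* (n C k)
[1+k]*[1+n]C[1+k]≡[1+n]*nCk zero    zero    = refl
[1+k]*[1+n]C[1+k]≡[1+n]*nCk zero    (suc k) =
  trans (cong (suc (suc k) ℕ.*_) (k>n⇒nCk≡0 {1} {suc (suc k)} (s≤s (s≤s z≤n)))) (ℕₚ.*-zeroʳ (suc (suc k)))
[1+k]*[1+n]C[1+k]≡[1+n]*nCk (suc n) zero    =
  trans (ℕₚ.*-identityˡ _) (trans (nC1≡n (suc (suc n))) (sym (ℕₚ.*-identityʳ _)))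
[1+k]*[1+n]C[1+k]≡[1+n]*nCk (suc n) (suc k) = begin
  (2 ℕ.+ k) ℕ.* ((2 ℕ.+ n) C (2 ℕ.+ k))                               ≡⟨ cong ((2 ℕ.+ k) ℕ.*_) (pascal (suc n) (suc k)) ⟩
  (2 ℕ.+ k) ℕ.* (c₁ ℕ.+ c₂)                                            ≡⟨ split k c₁ c₂ ⟩
  (1 ℕ.+ k) ℕ.* c₁ ℕ.+ c₁ ℕ.+ (2 ℕ.+ k) ℕ.* c₂                         ≡⟨ cong₂ (λ x y → x ℕ.+ c₁ ℕ.+ y)
                                                                            ([1+k]*[1+n]C[1+k]≡[1+n]*nCk n k)
                                                                            ([1+k]*[1+n]C[1+k]≡[1+n]*nCk n (suc k)) ⟩
  (1 ℕ.+ n) ℕ.* (n C k) ℕ.+ c₁ ℕ.+ (1 ℕ.+ n) ℕ.* (n C suc k)           ≡⟨ merge n (n C k) c₁ (n C suc k) ⟩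
  (1 ℕ.+ n) ℕ.* (n C k ℕ.+ n C suc k) ℕ.+ c₁                          ≡⟨ cong (λ x → (1 ℕ.+ n) ℕ.* x ℕ.+ c₁) (pascal n k) ⟨
  (1 ℕ.+ n) ℕ.* c₁ ℕ.+ c₁                                              ≡⟨ collect n c₁ ⟩
  (2 ℕ.+ n) ℕ.* c₁                                                     ∎
  where
  c₁ = suc n C suc k
  c₂ = suc n C suc (suc k)
  split : ∀ k x y → (2 ℕ.+ k) ℕ.* (x ℕ.+ y) ≡ (1 ℕ.+ k) ℕ.* x ℕ.+ x ℕ.+ (2 ℕ.+ k) ℕ.* y
  split = ℕ-solve-∀
  merge : ∀ n x y z → (1 ℕ.+ n) ℕ.* x ℕ.+ y ℕ.+ (1 ℕ.+ n) ℕ.* z ≡ (1 ℕ.+ n) ℕ.* (x ℕ.+ z) ℕ.+ y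
  merge = ℕ-solve-∀
  collect : ∀ n x → (1 ℕ.+ n) ℕ.* x ℕ.+ x ≡ (2 ℕ.+ n) ℕ.* x
  collect = ℕ-solve-∀

[1+n]*nCk+k*[1+n]Ck≡[1+n]*[1+n]Ck : ∀ n k → suc n ℕ.* (n C k) ℕ.+ k ℕ.* (suc n C k) ≡ suc n ℕ.* (suc n C k)
[1+n]*nCk+k*[1+n]Ck≡[1+n]*[1+n]Ck n zero    = ℕₚ.+-identityʳ _
[1+n]*nCk+k*[1+n]Ck≡[1+n]*[1+n]Ck n (suc k) = begin
  suc n ℕ.* (n C suc k) ℕ.+ suc k ℕ.* (suc n C suc k)  ≡⟨ cong (suc n ℕ.* (n C suc k) ℕ.+_) ([1+k]*[1+n]C[1+k]≡[1+n]*nCk n k) ⟩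
  suc n ℕ.* (n C suc k) ℕ.+ suc n ℕ.* (n C k)          ≡⟨ ℕₚ.+-comm (suc n ℕ.* (n C suc k)) _ ⟩
  suc n ℕ.* (n C k) ℕ.+ suc n ℕ.* (n C suc k)          ≡⟨ ℕₚ.*-distribˡ-+ (suc n) (n C k) (n C suc k) ⟨
  suc n ℕ.* (n C k ℕ.+ n C suc k)                      ≡⟨ cong (suc n ℕ.*_) (pascal n k) ⟨
  suc n ℕ.* (suc n C suc k)                            ∎

[1+n∸k]*[1+n]Ck≡[1+n]*nCk : ∀ {n k} → k ℕ.≤ n → suc (n ∸ k) ℕ.* (suc n C k) ≡ suc n ℕ.* (n C k)
[1+n∸k]*[1+n]Ck≡[1+n]*nCk {n} {k} k≤n = ℕₚ.+-cancelʳ-≡ (k ℕ.* (suc n C k)) _ _ (begin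
  suc (n ∸ k) ℕ.* (suc n C k) ℕ.+ k ℕ.* (suc n C k)  ≡⟨ ℕₚ.*-distribʳ-+ (suc n C k) (suc (n ∸ k)) k ⟨
  (suc (n ∸ k) ℕ.+ k) ℕ.* (suc n C k)                ≡⟨ cong (λ x → suc x ℕ.* (suc n C k)) (ℕₚ.m∸n+n≡m k≤n) ⟩
  suc n ℕ.* (suc n C k)                              ≡⟨ [1+n]*nCk+k*[1+n]Ck≡[1+n]*[1+n]Ck n k ⟨
  suc n ℕ.* (n C k) ℕ.+ k ℕ.* (suc n C k)            ∎)

[1+n]C[1+k]/[1+n]≡nCk/[1+k] : ∀ n k → ⟦ suc n C suc k ⟧ * recip (suc n) ≡ ⟦ n C k ⟧ * recip (suc k)
[1+n]C[1+k]/[1+n]≡nCk/[1+k] n k =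
  ⟦⟧-recip-from-* {suc k} {suc n C suc k} {suc n} {n C k} ([1+k]*[1+n]C[1+k]≡[1+n]*nCk n k)

[1+n]Ck/[1+n]≡nCk/[1+n∸k] : ∀ {n k} → k ℕ.≤ n → ⟦ suc n C k ⟧ * recip (suc n) ≡ ⟦ n C k ⟧ * recip (suc (n ∸ k))
[1+n]Ck/[1+n]≡nCk/[1+n∸k] {n} {k} k≤n =
  ⟦⟧-recip-from-* {suc (n ∸ k)} {suc n C k} {suc n} {n C k} ([1+n∸k]*[1+n]Ck≡[1+n]*nCk k≤n)

1/[1+n]C[1+k] : ∀ n k → recip (suc n C suc k) ≡ ⟦ suc k ⟧ * recip (suc n) * recip (n C k)
1/[1+n]C[1+k] n k = recip-from-* {suc k} {suc n C suc k} {suc n} {n C k} ([1+k]*[1+n]C[1+k]≡[1+n]*nCk n k)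

1/[1+n]Ck : ∀ {n k} → k ℕ.≤ n → recip (suc n C k) ≡ ⟦ suc (n ∸ k) ⟧ * recip (suc n) * recip (n C k)
1/[1+n]Ck {n} {k} k≤n = recip-from-* {suc (n ∸ k)} {suc n C k} {suc n} {n C k} ([1+n∸k]*[1+n]Ck≡[1+n]*nCk k≤n)

-- Finite sums

sum1-cong : ∀ n {f g : ℕ → ℚ} → (∀ k → k ℕ.< n → f (suc k) ≡ g (suc k)) → sum1 n f ≡ sum1 n g
sum1-cong zero    _  = refl
sum1-cong (suc n) eq = cong₂ _+_ (sum1-cong n (λ k k<n → eq k (ℕₚ.m<n⇒m<1+n k<n))) (eq n (ℕₚ.n<1+n n))

sum1-+ : ∀ n (f g : ℕ → ℚ) → sum1 n (λ k → f k + g k) ≡ sum1 n f + sum1 n g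
sum1-+ zero    f g = refl
sum1-+ (suc n) f g = trans (cong (_+ (f (suc n) + g (suc n))) (sum1-+ n f g))
                           (interchange (sum1 n f) (sum1 n g) (f (suc n)) (g (suc n)))
  where
  interchange : ∀ (a b c d : ℚ) → (a + b) + (c + d) ≡ (a + c) + (b + d)
  interchange = solve-∀ ℚ-ring

sum1-*ˡ : ∀ n c (f : ℕ → ℚ) → sum1 n (λ k → c * f k) ≡ c * sum1 n f
sum1-*ˡ zero    c f = sym (*-zeroʳ c)
sum1-*ˡ (suc n) c f = trans (cong (_+ c * f (suc n)) (sum1-*ˡ n c f))
                            (sym (*-distribˡ-+ c (sum1 n f) (f (suc n))))

sum1-neg : ∀ n (f : ℕ → ℚ) → sum1 n (λ k → - f k) ≡ - sum1 n f
sum1-neg zero    f = refl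
sum1-neg (suc n) f = trans (cong (_+ - f (suc n)) (sum1-neg n f)) (sym (neg-distrib-+ (sum1 n f) (f (suc n))))

sum1-sucˡ : ∀ n (f : ℕ → ℚ) → sum1 (suc n) f ≡ f 1 + sum1 n (λ k → f (suc k))
sum1-sucˡ zero    f = +-comm 0ℚ (f 1)
sum1-sucˡ (suc n) f = trans (cong (_+ f (2 ℕ.+ n)) (sum1-sucˡ n f)) (+-assoc (f 1) _ (f (2 ℕ.+ n)))

alternating-summation-by-parts : ∀ (h x : ℕ → ℚ) m →
  h 0 * (x 0 + x 1) + sum1 m (λ j → sgn j * h j * (x j + x (suc j)))
  ≡ h 0 * x 0 + sum1 m (λ j → sgn j * (h j - h (j ∸ 1)) * x j) + sgn m * h m * x (suc m)
alternating-summation-by-parts h x zero    = regroup₀ (h 0) (x 0) (x 1)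
  where
  regroup₀ : ∀ (h₀ x₀ x₁ : ℚ) → h₀ * (x₀ + x₁) + 0ℚ ≡ h₀ * x₀ + 0ℚ + 1ℚ * h₀ * x₁
  regroup₀ = solve-∀ ℚ-ring
alternating-summation-by-parts h x (suc m) = begin
  h 0 * (x 0 + x 1) + (S + t)                           ≡⟨ +-assoc (h 0 * (x 0 + x 1)) S t ⟨
  h 0 * (x 0 + x 1) + S + t                             ≡⟨ cong (_+ t) (alternating-summation-by-parts h x m) ⟩
  h 0 * x 0 + D + sgn m * h m * x (suc m) + t           ≡⟨ regroup (h 0 * x 0) D (sgn m) (h m) (h (suc m)) (x (suc m)) (x (2 ℕ.+ m)) ⟩
  h 0 * x 0 + (D + sgn (suc m) * (h (suc m) - h m) * x (suc m)) + sgn (suc m) * h (suc m) * x (2 ℕ.+ m) ∎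
  where
  S = sum1 m (λ j → sgn j * h j * (x j + x (suc j)))
  D = sum1 m (λ j → sgn j * (h j - h (j ∸ 1)) * x j)
  t = sgn (suc m) * h (suc m) * (x (suc m) + x (2 ℕ.+ m))
  regroup : ∀ (a d s h₀ h₁ x₁ x₂ : ℚ) →
            a + d + s * h₀ * x₁ + (- s) * h₁ * (x₁ + x₂) ≡ a + (d + (- s) * (h₁ - h₀) * x₁) + (- s) * h₁ * x₂
  regroup = solve-∀ ℚ-ring

-- Harmonic numbers and the transforms T and Δ

invPowSuc-1 : ∀ j → invPowSuc 1 j ≡ recip (suc j)
invPowSuc-1 j = cong (λ x → recip (suc x)) (ℕₚ.*-identityʳ j)

invPowSuc-2 : ∀ j → invPowSuc 2 j ≡ recip (suc j) * recip (suc j)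
invPowSuc-2 j = trans (cong (λ x → recip (suc j ℕ.* x)) (ℕₚ.*-identityʳ (suc j))) (recip-* (suc j) (suc j))

H-suc : ∀ m → H (suc m) ≡ H m + recip (suc m)
H-suc m = cong (λ x → H m + x) (invPowSuc-1 m)

H²-suc : ∀ m → H^ 2 (suc m) ≡ H^ 2 m + recip (suc m) * recip (suc m)
H²-suc m = cong (λ x → H^ 2 m + x) (invPowSuc-2 m)

conv : ℕ → (ℕ → ℚ) → (ℕ → ℚ) → ℚ
conv n c f = sum1 n (λ k → c k * f (n ∸ k))

conv-cong : ∀ n (c : ℕ → ℚ) {f g : ℕ → ℚ} → (∀ m → f m ≡ g m) → conv n c f ≡ conv n c g
conv-cong n c f≗g = sum1-cong n (λ k _ → cong (c (suc k) *_) (f≗g (n ∸ suc k)))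

conv-+ : ∀ n (c f g : ℕ → ℚ) → conv n c (λ m → f m + g m) ≡ conv n c f + conv n c g
conv-+ n c f g = trans (sum1-cong n (λ k _ → *-distribˡ-+ (c (suc k)) (f (n ∸ suc k)) (g (n ∸ suc k))))
                       (sum1-+ n _ _)

conv-*ˡ : ∀ n (c : ℕ → ℚ) a (f : ℕ → ℚ) → conv n c (λ m → a * f m) ≡ a * conv n c f
conv-*ˡ n c a f = trans (sum1-cong n (λ k _ → swap (c (suc k)) a (f (n ∸ suc k)))) (sum1-*ˡ n a _)
  where
  swap : ∀ (x y z : ℚ) → x * (y * z) ≡ y * (x * z)
  swap = solve-∀ ℚ-ring

T-coeff Δ-coeff : ℕ → ℕ → ℚ
T-coeff n k = sgn (k ∸ 1) * recip k * ⟦ n C k ⟧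
Δ-coeff n k = sgn k * ⟦ n C k ⟧

T : (ℕ → ℚ) → ℕ → ℚ
T f n = conv n (T-coeff n) f

-- The n-th forward difference of f at 0.
Δ : (ℕ → ℚ) → ℕ → ℚ
Δ f n = f n + conv n (Δ-coeff n) f

conv-pascal : ∀ n (c f : ℕ → ℚ) →
  conv (suc n) (λ k → c k * ⟦ suc n C k ⟧) f
  ≡ conv n (λ k → c k * ⟦ n C k ⟧) (λ m → f (suc m)) + conv (suc n) (λ k → c k * ⟦ n C (k ∸ 1) ⟧) f
conv-pascal n c f = begin
  conv (suc n) (λ k → c k * ⟦ suc n C k ⟧) f           ≡⟨ sum1-cong (suc n) (λ k _ → split k) ⟩
  sum1 (suc n) (λ k → X k + Y k)                         ≡⟨ sum1-+ (suc n) X Y ⟩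
  sum1 n X + X (suc n) + sum1 (suc n) Y                  ≡⟨ cong (λ x → sum1 n X + x + sum1 (suc n) Y) X-last ⟩
  sum1 n X + 0ℚ + sum1 (suc n) Y                         ≡⟨ cong (_+ sum1 (suc n) Y) (+-identityʳ (sum1 n X)) ⟩
  sum1 n X + sum1 (suc n) Y                              ≡⟨ cong (_+ sum1 (suc n) Y) (sum1-cong n X-shift) ⟩
  conv n (λ k → c k * ⟦ n C k ⟧) (λ m → f (suc m)) + sum1 (suc n) Y ∎
  where
  X Y : ℕ → ℚ
  X k = c k * ⟦ n C k ⟧ * f (suc n ∸ k)
  Y k = c k * ⟦ n C (k ∸ 1) ⟧ * f (suc n ∸ k)
  distrib : ∀ (a x y z : ℚ) → a * (y + x) * z ≡ a * x * z + a * y * z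
  distrib = solve-∀ ℚ-ring
  split : ∀ k → c (suc k) * ⟦ suc n C suc k ⟧ * f (n ∸ k) ≡ X (suc k) + Y (suc k)
  split k = trans (cong (λ x → c (suc k) * x * f (n ∸ k)) (trans (cong ⟦_⟧ (pascal n k)) (⟦⟧-+ (n C k) (n C suc k))))
                  (distrib (c (suc k)) (⟦ n C suc k ⟧) (⟦ n C k ⟧) (f (n ∸ k)))
  X-last : X (suc n) ≡ 0ℚ
  X-last = trans (cong (λ x → c (suc n) * ⟦ x ⟧ * f (n ∸ n)) (k>n⇒nCk≡0 (ℕₚ.n<1+n n)))
                 (trans (cong (_* f (n ∸ n)) (*-zeroʳ (c (suc n)))) (*-zeroˡ (f (n ∸ n))))
  X-shift : ∀ k → k ℕ.< n → X (suc k) ≡ c (suc k) * ⟦ n C suc k ⟧ * f (suc (n ∸ suc k))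
  X-shift k k<n = cong (λ m → c (suc k) * ⟦ n C suc k ⟧ * f m) (ℕₚ.+-∸-assoc 1 k<n)

Δ-suc : ∀ (f : ℕ → ℚ) n → Δ f (suc n) ≡ Δ (λ m → f (suc m)) n - Δ f n
Δ-suc f n = begin
  f (suc n) + conv (suc n) (Δ-coeff (suc n)) f
    ≡⟨ cong (λ x → f (suc n) + x) (conv-pascal n sgn f) ⟩
  f (suc n) + (conv n (Δ-coeff n) (λ m → f (suc m)) + sum1 (suc n) Y)
    ≡⟨ cong (λ x → f (suc n) + (conv n (Δ-coeff n) (λ m → f (suc m)) + x)) Y-sum ⟩
  f (suc n) + (conv n (Δ-coeff n) (λ m → f (suc m)) + - Δ f n)
    ≡⟨ +-assoc (f (suc n)) _ (- Δ f n) ⟨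
  Δ (λ m → f (suc m)) n - Δ f n ∎
  where
  Y : ℕ → ℚ
  Y k = sgn k * ⟦ n C (k ∸ 1) ⟧ * f (suc n ∸ k)
  Y-sum : sum1 (suc n) Y ≡ - Δ f n
  Y-sum = begin
    sum1 (suc n) Y                                                   ≡⟨ sum1-sucˡ n Y ⟩
    Y 1 + sum1 n (λ k → Y (suc k))                                    ≡⟨ cong (λ x → Y 1 + x) (trans (sum1-cong n (λ k _ → neg-out (sgn (suc k)) _ _)) (sum1-neg n _)) ⟩
    Y 1 + - conv n (Δ-coeff n) f                        ≡⟨ cong (_+ - conv n (Δ-coeff n) f) (neg-first (f n)) ⟩
    - f n + - conv n (Δ-coeff n) f                      ≡⟨ neg-distrib-+ (f n) _ ⟨
    - Δ f n                                                           ∎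
    where
    neg-first : ∀ (x : ℚ) → - (1ℚ) * 1ℚ * x ≡ - x
    neg-first = solve-∀ ℚ-ring
    neg-out : ∀ (s c x : ℚ) → (- s) * c * x ≡ - (s * c * x)
    neg-out = solve-∀ ℚ-ring

T-suc : ∀ (f : ℕ → ℚ) n → T f (suc n) ≡ T (λ m → f (suc m)) n + recip (suc n) * (f (suc n) - Δ f (suc n))
T-suc f n = begin
  T f (suc n)                                             ≡⟨ conv-pascal n (λ k → sgn (k ∸ 1) * recip k) f ⟩
  T (λ m → f (suc m)) n + sum1 (suc n) Y                  ≡⟨ cong (λ x → T (λ m → f (suc m)) n + x) Y-sum ⟩
  T (λ m → f (suc m)) n + recip (suc n) * (f (suc n) - Δ f (suc n)) ∎
  where
  Y : ℕ → ℚ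
  Y k = sgn (k ∸ 1) * recip k * ⟦ n C (k ∸ 1) ⟧ * f (suc n ∸ k)
  Z : ℚ
  Z = conv (suc n) (Δ-coeff (suc n)) f
  absorb : ∀ k → Y (suc k) ≡ recip (suc n) * - (sgn (suc k) * ⟦ suc n C suc k ⟧ * f (n ∸ k))
  absorb k = begin
    sgn k * recip (suc k) * ⟦ n C k ⟧ * f (n ∸ k)         ≡⟨ regroup (sgn k) (recip (suc k)) ⟦ n C k ⟧ (f (n ∸ k)) ⟩
    sgn k * (⟦ n C k ⟧ * recip (suc k)) * f (n ∸ k)       ≡⟨ cong (λ x → sgn k * x * f (n ∸ k)) ([1+n]C[1+k]/[1+n]≡nCk/[1+k] n k) ⟨
    sgn k * (⟦ suc n C suc k ⟧ * recip (suc n)) * f (n ∸ k) ≡⟨ extract (sgn k) ⟦ suc n C suc k ⟧ (recip (suc n)) (f (n ∸ k)) ⟩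
    recip (suc n) * - (- sgn k * ⟦ suc n C suc k ⟧ * f (n ∸ k)) ∎
    where
    regroup : ∀ (s i c x : ℚ) → s * i * c * x ≡ s * (c * i) * x
    regroup = solve-∀ ℚ-ring
    extract : ∀ (s c r x : ℚ) → s * (c * r) * x ≡ r * - ((- s) * c * x)
    extract = solve-∀ ℚ-ring
  Y-sum : sum1 (suc n) Y ≡ recip (suc n) * (f (suc n) - Δ f (suc n))
  Y-sum = begin
    sum1 (suc n) Y                        ≡⟨ sum1-cong (suc n) (λ k _ → absorb k) ⟩
    sum1 (suc n) (λ k → recip (suc n) * - (sgn k * ⟦ suc n C k ⟧ * f (suc n ∸ k)))
                                          ≡⟨ trans (sum1-*ˡ (suc n) (recip (suc n)) _) (cong (recip (suc n) *_) (sum1-neg (suc n) _)) ⟩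
    recip (suc n) * - Z                   ≡⟨ cong (recip (suc n) *_) (neg-as-difference (f (suc n)) Z) ⟩
    recip (suc n) * (f (suc n) - Δ f (suc n)) ∎
    where
    neg-as-difference : ∀ (x z : ℚ) → - z ≡ x - (x + z)
    neg-as-difference = solve-∀ ℚ-ring

conv-recip-suc : ∀ n (c g : ℕ → ℚ) →
  conv n (λ k → c k * ⟦ n C k ⟧) (λ m → recip (suc m) * g (suc m))
  ≡ recip (suc n) * (conv (suc n) (λ k → c k * ⟦ suc n C k ⟧) g - c (suc n) * g 0)
conv-recip-suc n c g = begin
  conv n (λ k → c k * ⟦ n C k ⟧) (λ m → recip (suc m) * g (suc m))  ≡⟨ sum1-cong n absorb ⟩
  sum1 n (λ k → recip (suc n) * X k)                                 ≡⟨ sum1-*ˡ n (recip (suc n)) X ⟩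
  recip (suc n) * sum1 n X                                           ≡⟨ cong (recip (suc n) *_) (add-subtract (sum1 n X) (c (suc n)) (g 0)) ⟩
  recip (suc n) * (sum1 n X + c (suc n) * 1ℚ * g 0 - c (suc n) * g 0) ≡⟨ cong (λ x → recip (suc n) * (sum1 n X + x - c (suc n) * g 0)) X-last ⟨
  recip (suc n) * (conv (suc n) (λ k → c k * ⟦ suc n C k ⟧) g - c (suc n) * g 0) ∎
  where
  X : ℕ → ℚ
  X k = c k * ⟦ suc n C k ⟧ * g (suc n ∸ k)
  X-last : X (suc n) ≡ c (suc n) * 1ℚ * g 0
  X-last = cong₂ (λ a b → c (suc n) * ⟦ a ⟧ * g b) (nCn≡1 (suc n)) (ℕₚ.n∸n≡0 n)
  add-subtract : ∀ (s a b : ℚ) → s ≡ s + a * 1ℚ * b - a * b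
  add-subtract = solve-∀ ℚ-ring
  absorb : ∀ k → k ℕ.< n →
           c (suc k) * ⟦ n C suc k ⟧ * (recip (suc (n ∸ suc k)) * g (suc (n ∸ suc k))) ≡ recip (suc n) * X (suc k)
  absorb k k<n = begin
    c (suc k) * ⟦ n C suc k ⟧ * (recip (suc (n ∸ suc k)) * g (suc (n ∸ suc k)))
      ≡⟨ regroup (c (suc k)) ⟦ n C suc k ⟧ _ _ ⟩
    c (suc k) * (⟦ n C suc k ⟧ * recip (suc (n ∸ suc k))) * g (suc (n ∸ suc k))
      ≡⟨ cong₂ (λ x m → c (suc k) * x * g m) ([1+n]Ck/[1+n]≡nCk/[1+n∸k] k<n) (ℕₚ.+-∸-assoc 1 k<n) ⟨
    c (suc k) * (⟦ suc n C suc k ⟧ * recip (suc n)) * g (n ∸ k)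
      ≡⟨ extract (c (suc k)) ⟦ suc n C suc k ⟧ (recip (suc n)) (g (n ∸ k)) ⟩
    recip (suc n) * X (suc k) ∎
    where
    regroup : ∀ (a b i y : ℚ) → a * b * (i * y) ≡ a * (b * i) * y
    regroup = solve-∀ ℚ-ring
    extract : ∀ (a b r y : ℚ) → a * (b * r) * y ≡ r * (a * b * y)
    extract = solve-∀ ℚ-ring

Δ-recip-suc : ∀ (g : ℕ → ℚ) n →
  Δ (λ m → recip (suc m) * g (suc m)) n ≡ recip (suc n) * (Δ g (suc n) - sgn (suc n) * g 0)
Δ-recip-suc g n = begin
  recip (suc n) * g (suc n) + conv n (Δ-coeff n) (λ m → recip (suc m) * g (suc m))
    ≡⟨ cong (λ x → recip (suc n) * g (suc n) + x) (conv-recip-suc n sgn g) ⟩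
  recip (suc n) * g (suc n) + recip (suc n) * (conv (suc n) (Δ-coeff (suc n)) g - sgn (suc n) * g 0)
    ≡⟨ factor (recip (suc n)) (g (suc n)) _ (sgn (suc n) * g 0) ⟩
  recip (suc n) * (Δ g (suc n) - sgn (suc n) * g 0) ∎
  where
  factor : ∀ (r a b c : ℚ) → r * a + r * (b - c) ≡ r * (a + b - c)
  factor = solve-∀ ℚ-ring

T-recip-suc : ∀ (g : ℕ → ℚ) n →
  T (λ m → recip (suc m) * g (suc m)) n ≡ recip (suc n) * (T g (suc n) - sgn n * recip (suc n) * g 0)
T-recip-suc g n = conv-recip-suc n (λ k → sgn (k ∸ 1) * recip k) g

Δ-cong : ∀ {f g : ℕ → ℚ} n → (∀ m → f m ≡ g m) → Δ f n ≡ Δ g n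
Δ-cong n f≗g = cong₂ _+_ (f≗g n) (conv-cong n (Δ-coeff n) f≗g)

Δ-+ : ∀ (f g : ℕ → ℚ) n → Δ (λ m → f m + g m) n ≡ Δ f n + Δ g n
Δ-+ f g n = trans (cong (λ x → f n + g n + x) (conv-+ n (Δ-coeff n) f g)) (interchange (f n) (g n) _ _)
  where
  interchange : ∀ (a b c d : ℚ) → a + b + (c + d) ≡ (a + c) + (b + d)
  interchange = solve-∀ ℚ-ring

Δ-*ˡ : ∀ a (f : ℕ → ℚ) n → Δ (λ m → a * f m) n ≡ a * Δ f n
Δ-*ˡ a f n = trans (cong (λ x → a * f n + x) (conv-*ˡ n (Δ-coeff n) a f)) (sym (*-distribˡ-+ a (f n) _))

Δ-const : ∀ n → Δ (λ _ → 1ℚ) (suc n) ≡ 0ℚ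
Δ-const n = trans (Δ-suc (λ _ → 1ℚ) n) (+-inverseʳ (Δ (λ _ → 1ℚ) n))

T-const : ∀ n → T (λ _ → 1ℚ) n ≡ H n
T-const zero    = refl
T-const (suc n) = begin
  T (λ _ → 1ℚ) (suc n)                                        ≡⟨ T-suc (λ _ → 1ℚ) n ⟩
  T (λ _ → 1ℚ) n + recip (suc n) * (1ℚ - Δ (λ _ → 1ℚ) (suc n)) ≡⟨ cong₂ (λ x y → x + recip (suc n) * (1ℚ - y)) (T-const n) (Δ-const n) ⟩
  H n + recip (suc n) * (1ℚ - 0ℚ)                              ≡⟨ simplify (H n) (recip (suc n)) ⟩
  H n + recip (suc n)                                          ≡⟨ H-suc n ⟨
  H (suc n)                                                    ∎
  where
  simplify : ∀ (h r : ℚ) → h + r * (1ℚ - 0ℚ) ≡ h + r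
  simplify = solve-∀ ℚ-ring

Δ-recip : ∀ n → Δ (λ m → recip (suc m)) n ≡ sgn n * recip (suc n)
Δ-recip n = begin
  Δ (λ m → recip (suc m)) n                                        ≡⟨ Δ-cong n (λ m → *-identityʳ (recip (suc m))) ⟨
  Δ (λ m → recip (suc m) * 1ℚ) n                                   ≡⟨ Δ-recip-suc (λ _ → 1ℚ) n ⟩
  recip (suc n) * (Δ (λ _ → 1ℚ) (suc n) - sgn (suc n) * 1ℚ)        ≡⟨ cong (λ x → recip (suc n) * (x - sgn (suc n) * 1ℚ)) (Δ-const n) ⟩
  recip (suc n) * (0ℚ - - sgn n * 1ℚ)                              ≡⟨ simplify (recip (suc n)) (sgn n) ⟩
  sgn n * recip (suc n)                                            ∎
  where
  simplify : ∀ (r s : ℚ) → r * (0ℚ - (- s) * 1ℚ) ≡ s * r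
  simplify = solve-∀ ℚ-ring

Δ-H : ∀ n → Δ H (suc n) ≡ sgn n * recip (suc n)
Δ-H n = begin
  Δ H (suc n)                                         ≡⟨ Δ-suc H n ⟩
  Δ (λ m → H (suc m)) n - Δ H n                       ≡⟨ cong (_- Δ H n) (trans (Δ-cong n H-suc) (Δ-+ H (λ m → recip (suc m)) n)) ⟩
  Δ H n + Δ (λ m → recip (suc m)) n - Δ H n           ≡⟨ cancel (Δ H n) _ ⟩
  Δ (λ m → recip (suc m)) n                           ≡⟨ Δ-recip n ⟩
  sgn n * recip (suc n)                               ∎
  where
  cancel : ∀ (a b : ℚ) → a + b - a ≡ b
  cancel = solve-∀ ℚ-ring

H²+H^2 : ℕ → ℚ
H²+H^2 m = H m * H m + H^ 2 m

H²+H^2-suc : ∀ m → H²+H^2 (suc m) ≡ H²+H^2 m + ⟦ 2 ⟧ * (recip (suc m) * H (suc m))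
H²+H^2-suc m = begin
  H (suc m) * H (suc m) + H^ 2 (suc m)           ≡⟨ cong₂ (λ x y → x * x + y) (H-suc m) (H²-suc m) ⟩
  (H m + r) * (H m + r) + (H^ 2 m + r * r)       ≡⟨ expand (H m) (H^ 2 m) r ⟩
  H²+H^2 m + ⟦ 2 ⟧ * (r * (H m + r))             ≡⟨ cong (λ x → H²+H^2 m + ⟦ 2 ⟧ * (r * x)) (H-suc m) ⟨
  H²+H^2 m + ⟦ 2 ⟧ * (r * H (suc m))             ∎
  where
  r = recip (suc m)
  expand : ∀ (h h₂ r : ℚ) → (h + r) * (h + r) + (h₂ + r * r) ≡ h * h + h₂ + ⟦ 2 ⟧ * (r * (h + r))
  expand = solve-∀ ℚ-ring

Δ-H²+H^2 : ∀ n → Δ H²+H^2 (suc n) ≡ ⟦ 2 ⟧ * sgn n * recip (suc n) * recip (suc n)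
Δ-H²+H^2 n = begin
  Δ H²+H^2 (suc n)                                       ≡⟨ Δ-suc H²+H^2 n ⟩
  Δ (λ m → H²+H^2 (suc m)) n - Δ H²+H^2 n                ≡⟨ cong (_- Δ H²+H^2 n) (trans (Δ-cong n H²+H^2-suc) (Δ-+ H²+H^2 (λ m → ⟦ 2 ⟧ * G m) n)) ⟩
  Δ H²+H^2 n + Δ (λ m → ⟦ 2 ⟧ * G m) n - Δ H²+H^2 n      ≡⟨ cong (λ x → Δ H²+H^2 n + x - Δ H²+H^2 n) (Δ-*ˡ ⟦ 2 ⟧ G n) ⟩
  Δ H²+H^2 n + ⟦ 2 ⟧ * Δ G n - Δ H²+H^2 n                ≡⟨ cong (λ x → Δ H²+H^2 n + ⟦ 2 ⟧ * x - Δ H²+H^2 n) (Δ-recip-suc H n) ⟩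
  Δ H²+H^2 n + ⟦ 2 ⟧ * (r * (Δ H (suc n) - sgn (suc n) * 0ℚ)) - Δ H²+H^2 n
                                                          ≡⟨ cong (λ x → Δ H²+H^2 n + ⟦ 2 ⟧ * (r * (x - sgn (suc n) * 0ℚ)) - Δ H²+H^2 n) (Δ-H n) ⟩
  Δ H²+H^2 n + ⟦ 2 ⟧ * (r * (sgn n * r - sgn (suc n) * 0ℚ)) - Δ H²+H^2 n
                                                          ≡⟨ simplify (Δ H²+H^2 n) (sgn n) r ⟩
  ⟦ 2 ⟧ * sgn n * r * r                                   ∎
  where
  r = recip (suc n)
  G : ℕ → ℚ
  G m = recip (suc m) * H (suc m)
  simplify : ∀ (d s r : ℚ) → d + ⟦ 2 ⟧ * (r * (s * r - (- s) * 0ℚ)) - d ≡ ⟦ 2 ⟧ * s * r * r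
  simplify = solve-∀ ℚ-ring

T-H²+H^2-suc : ∀ n → T H²+H^2 (suc n)
  ≡ T H²+H^2 n + recip (suc n) * (⟦ 2 ⟧ * T H (suc n) + H²+H^2 (suc n) - ⟦ 2 ⟧ * sgn n * recip (suc n) * recip (suc n))
T-H²+H^2-suc n = begin
  T H²+H^2 (suc n)                                             ≡⟨ T-suc H²+H^2 n ⟩
  T (λ m → H²+H^2 (suc m)) n + r * (H²+H^2 (suc n) - Δ H²+H^2 (suc n))
                                                               ≡⟨ cong₂ (λ x y → x + r * (H²+H^2 (suc n) - y)) shifted (Δ-H²+H^2 n) ⟩
  T H²+H^2 n + ⟦ 2 ⟧ * (r * (T H (suc n) - sgn n * r * 0ℚ)) + r * (H²+H^2 (suc n) - ⟦ 2 ⟧ * sgn n * r * r)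
                                                               ≡⟨ collect (T H²+H^2 n) (T H (suc n)) (sgn n) r (H²+H^2 (suc n)) ⟩
  T H²+H^2 n + r * (⟦ 2 ⟧ * T H (suc n) + H²+H^2 (suc n) - ⟦ 2 ⟧ * sgn n * r * r) ∎
  where
  r = recip (suc n)
  G : ℕ → ℚ
  G m = recip (suc m) * H (suc m)
  shifted : T (λ m → H²+H^2 (suc m)) n ≡ T H²+H^2 n + ⟦ 2 ⟧ * (r * (T H (suc n) - sgn n * r * 0ℚ))
  shifted = begin
    T (λ m → H²+H^2 (suc m)) n                  ≡⟨ conv-cong n (T-coeff n) H²+H^2-suc ⟩
    T (λ m → H²+H^2 m + ⟦ 2 ⟧ * G m) n          ≡⟨ conv-+ n (T-coeff n) H²+H^2 (λ m → ⟦ 2 ⟧ * G m) ⟩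
    T H²+H^2 n + T (λ m → ⟦ 2 ⟧ * G m) n        ≡⟨ cong (λ x → T H²+H^2 n + x) (conv-*ˡ n (T-coeff n) ⟦ 2 ⟧ G) ⟩
    T H²+H^2 n + ⟦ 2 ⟧ * T G n                  ≡⟨ cong (λ x → T H²+H^2 n + ⟦ 2 ⟧ * x) (T-recip-suc H n) ⟩
    T H²+H^2 n + ⟦ 2 ⟧ * (r * (T H (suc n) - sgn n * r * 0ℚ)) ∎
  collect : ∀ (L t s r a : ℚ) → L + ⟦ 2 ⟧ * (r * (t - s * r * 0ℚ)) + r * (a - ⟦ 2 ⟧ * s * r * r)
                              ≡ L + r * (⟦ 2 ⟧ * t + a - ⟦ 2 ⟧ * s * r * r)
  collect = solve-∀ ℚ-ring

-- The alternating sums V and A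

V : (ℕ → ℚ) → ℕ → ℚ
V w n = sum1 n (λ k → sgn k * w k * (recip k * recip k) * recip (n C k))

A : (ℕ → ℚ) → ℕ → ℚ
A w m = w 1 + sum1 m (λ j → sgn j * w (suc j) * recip (m C j))

⟦1+m∸k⟧+⟦k⟧ : ∀ {m k} → k ℕ.≤ m → ⟦ suc (m ∸ k) ⟧ + ⟦ k ⟧ ≡ ⟦ suc m ⟧
⟦1+m∸k⟧+⟦k⟧ {m} {k} k≤m = trans (sym (⟦⟧-+ (suc (m ∸ k)) k)) (cong (λ x → ⟦ suc x ⟧) (ℕₚ.m∸n+n≡m k≤m))

1/mCj≡[1+m]/[2+m]*[1/[1+m]Cj+1/[1+m]C[1+j]] : ∀ {m j} → j ℕ.≤ m →
  recip (m C j) ≡ ⟦ suc m ⟧ * recip (2 ℕ.+ m) * (recip (suc m C j) + recip (suc m C suc j))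
1/mCj≡[1+m]/[2+m]*[1/[1+m]Cj+1/[1+m]C[1+j]] {m} {j} j≤m = sym (begin
  ⟦ suc m ⟧ * r₂ * (recip (suc m C j) + recip (suc m C suc j))
    ≡⟨ cong₂ (λ x y → ⟦ suc m ⟧ * r₂ * (x + y)) (1/[1+n]Ck j≤m) (1/[1+n]C[1+k] m j) ⟩
  ⟦ suc m ⟧ * r₂ * (⟦ suc (m ∸ j) ⟧ * r₁ * x + ⟦ suc j ⟧ * r₁ * x)
    ≡⟨ regroup ⟦ suc m ⟧ r₂ ⟦ suc (m ∸ j) ⟧ ⟦ suc j ⟧ r₁ x ⟩
  (r₁ * ⟦ suc m ⟧) * ((⟦ suc (m ∸ j) ⟧ + ⟦ suc j ⟧) * r₂) * x
    ≡⟨ cong (λ y → (r₁ * ⟦ suc m ⟧) * (y * r₂) * x) (⟦1+m∸k⟧+⟦k⟧ (s≤s j≤m)) ⟩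
  (r₁ * ⟦ suc m ⟧) * (⟦ 2 ℕ.+ m ⟧ * r₂) * x
    ≡⟨ cong₂ (λ y z → y * z * x) (recip-inverse (suc m)) (trans (*-comm ⟦ 2 ℕ.+ m ⟧ r₂) (recip-inverse (2 ℕ.+ m))) ⟩
  1ℚ * 1ℚ * x
    ≡⟨ trans (cong (_* x) (*-identityˡ 1ℚ)) (*-identityˡ x) ⟩
  x ∎)
  where
  r₁ = recip (suc m)
  r₂ = recip (2 ℕ.+ m)
  x = recip (m C j)
  regroup : ∀ (a r₂ b c r₁ x : ℚ) → a * r₂ * (b * r₁ * x + c * r₁ * x) ≡ (r₁ * a) * ((b + c) * r₂) * x
  regroup = solve-∀ ℚ-ring

1/[1+k]*1/[1+m]C[1+k] : ∀ m k → recip (suc k) * recip (suc m C suc k) ≡ recip (suc m) * recip (m C k)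
1/[1+k]*1/[1+m]C[1+k] m k = begin
  recip (suc k) * recip (suc m C suc k)                    ≡⟨ cong (recip (suc k) *_) (1/[1+n]C[1+k] m k) ⟩
  recip (suc k) * (⟦ suc k ⟧ * recip (suc m) * recip (m C k)) ≡⟨ regroup (recip (suc k)) ⟦ suc k ⟧ _ _ ⟩
  (recip (suc k) * ⟦ suc k ⟧) * (recip (suc m) * recip (m C k)) ≡⟨ cong (_* (recip (suc m) * recip (m C k))) (recip-inverse (suc k)) ⟩
  1ℚ * (recip (suc m) * recip (m C k))                     ≡⟨ *-identityˡ _ ⟩
  recip (suc m) * recip (m C k)                            ∎
  where
  regroup : ∀ (a b c d : ℚ) → a * (b * c * d) ≡ (a * b) * (c * d)
  regroup = solve-∀ ℚ-ring

1/k²C-recurrence : ∀ {m k} → k ℕ.≤ m →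
  recip (suc k) * recip (suc k) * recip ((2 ℕ.+ m) C suc k)
  ≡ recip (suc k) * recip (suc k) * recip (suc m C suc k) - recip (2 ℕ.+ m) * (recip (suc m) * recip (m C k))
1/k²C-recurrence {m} {k} k≤m = begin
  r * r * recip ((2 ℕ.+ m) C suc k)                      ≡⟨ cong (r * r *_) (1/[1+n]Ck (s≤s k≤m)) ⟩
  r * r * (⟦ suc (m ∸ k) ⟧ * r₂ * y)                   ≡⟨ cong (λ a → r * r * (a * r₂ * y)) complement ⟩
  r * r * ((⟦ 2 ℕ.+ m ⟧ - ⟦ suc k ⟧) * r₂ * y)         ≡⟨ regroup r ⟦ 2 ℕ.+ m ⟧ ⟦ suc k ⟧ r₂ y ⟩
  r * r * y * (r₂ * ⟦ 2 ℕ.+ m ⟧) - (r * ⟦ suc k ⟧) * r₂ * (r * y)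
                                                       ≡⟨ cong₂ (λ a b → r * r * y * a - b * r₂ * (r * y)) (recip-inverse (2 ℕ.+ m)) (recip-inverse (suc k)) ⟩
  r * r * y * 1ℚ - 1ℚ * r₂ * (r * y)                   ≡⟨ cong (λ a → r * r * y * 1ℚ - 1ℚ * r₂ * a) (1/[1+k]*1/[1+m]C[1+k] m k) ⟩
  r * r * y * 1ℚ - 1ℚ * r₂ * (recip (suc m) * recip (m C k)) ≡⟨ drop-ones (r * r * y) r₂ _ ⟩
  r * r * y - r₂ * (recip (suc m) * recip (m C k))     ∎
  where
  r = recip (suc k)
  r₂ = recip (2 ℕ.+ m)
  y = recip (suc m C suc k)
  complement : ⟦ suc (m ∸ k) ⟧ ≡ ⟦ 2 ℕ.+ m ⟧ - ⟦ suc k ⟧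
  complement = trans (add-sub ⟦ suc (m ∸ k) ⟧ ⟦ suc k ⟧) (cong (_- ⟦ suc k ⟧) (⟦1+m∸k⟧+⟦k⟧ (s≤s k≤m)))
    where
    add-sub : ∀ (a b : ℚ) → a ≡ a + b - b
    add-sub = solve-∀ ℚ-ring
  regroup : ∀ (r a b r₂ y : ℚ) → r * r * ((a - b) * r₂ * y) ≡ r * r * y * (r₂ * a) - (r * b) * r₂ * (r * y)
  regroup = solve-∀ ℚ-ring
  drop-ones : ∀ (a b c : ℚ) → a * 1ℚ - 1ℚ * b * c ≡ a - b * c
  drop-ones = solve-∀ ℚ-ring

V-suc-suc : ∀ (w : ℕ → ℚ) m →
  V w (2 ℕ.+ m) ≡ V w (suc m) + sgn (2 ℕ.+ m) * w (2 ℕ.+ m) * (recip (2 ℕ.+ m) * recip (2 ℕ.+ m))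
                  + recip (2 ℕ.+ m) * recip (suc m) * A w m
V-suc-suc w m = begin
  sum1 (suc m) F₂ + F₂ (2 ℕ.+ m)
    ≡⟨ cong₂ _+_ (sum1-cong (suc m) (λ k k<1+m → step k (ℕₚ.≤-pred k<1+m))) last ⟩
  sum1 (suc m) (λ k → F₁ k + r₂ * - G k) + t * 1ℚ
    ≡⟨ cong (_+ t * 1ℚ) (trans (sum1-+ (suc m) F₁ _) (cong (λ x → V w (suc m) + x) G-part)) ⟩
  V w (suc m) + r₂ * - - (recip (suc m) * A w m) + t * 1ℚ
    ≡⟨ simplify (V w (suc m)) r₂ (recip (suc m)) (A w m) t ⟩
  V w (suc m) + t + r₂ * recip (suc m) * A w m ∎
  where
  r₂ = recip (2 ℕ.+ m)
  F₁ F₂ G : ℕ → ℚ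
  F₁ k = sgn k * w k * (recip k * recip k) * recip (suc m C k)
  F₂ k = sgn k * w k * (recip k * recip k) * recip ((2 ℕ.+ m) C k)
  G  k = sgn k * w k * (recip (suc m) * recip (m C (k ∸ 1)))
  t = sgn (2 ℕ.+ m) * w (2 ℕ.+ m) * (r₂ * r₂)
  step : ∀ k → k ℕ.≤ m → F₂ (suc k) ≡ F₁ (suc k) + r₂ * - G (suc k)
  step k k≤m = begin
    s * a * (r * r) * recip ((2 ℕ.+ m) C suc k)       ≡⟨ assoc s a (r * r) _ ⟩
    s * a * (r * r * recip ((2 ℕ.+ m) C suc k))       ≡⟨ cong (s * a *_) (1/k²C-recurrence k≤m) ⟩
    s * a * (r * r * recip (suc m C suc k) - r₂ * z) ≡⟨ distribute s a (r * r) _ r₂ z ⟩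
    F₁ (suc k) + r₂ * - G (suc k)                   ∎
    where
    s = sgn (suc k)
    a = w (suc k)
    r = recip (suc k)
    z = recip (suc m) * recip (m C k)
    assoc : ∀ (s a b c : ℚ) → s * a * b * c ≡ s * a * (b * c)
    assoc = solve-∀ ℚ-ring
    distribute : ∀ (s a b c r z : ℚ) → s * a * (b * c - r * z) ≡ s * a * b * c + r * - (s * a * z)
    distribute = solve-∀ ℚ-ring
  last : F₂ (2 ℕ.+ m) ≡ t * 1ℚ
  last = cong (λ x → t * recip x) (nCn≡1 (2 ℕ.+ m))
  G-sum : sum1 (suc m) G ≡ - (recip (suc m) * A w m)
  G-sum = begin
    sum1 (suc m) G                                   ≡⟨ sum1-sucˡ m G ⟩
    G 1 + sum1 m (λ j → G (suc j))
      ≡⟨ cong (λ x → G 1 + x) (sum1-cong m (λ j _ → neg-out (sgn (suc j)) (w (2 ℕ.+ j)) (recip (suc m)) (recip (m C suc j)))) ⟩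
    G 1 + sum1 m (λ j → recip (suc m) * - (sgn j * w (suc j) * recip (m C j)))
                                                     ≡⟨ cong (λ x → G 1 + x) (trans (sum1-*ˡ m (recip (suc m)) _) (cong (recip (suc m) *_) (sum1-neg m _))) ⟩
    G 1 + recip (suc m) * - S                        ≡⟨ collect (w 1) (recip (suc m)) S ⟩
    - (recip (suc m) * A w m)                        ∎
    where
    S = sum1 m (λ j → sgn j * w (suc j) * recip (m C j))
    neg-out : ∀ (s a r x : ℚ) → (- s) * a * (r * x) ≡ r * - (s * a * x)
    neg-out = solve-∀ ℚ-ring
    collect : ∀ (a r S : ℚ) → (- 1ℚ) * a * (r * 1ℚ) + r * - S ≡ - (r * (a + S))
    collect = solve-∀ ℚ-ring
  G-part : sum1 (suc m) (λ k → r₂ * - G k) ≡ r₂ * - - (recip (suc m) * A w m)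
  G-part = trans (sum1-*ˡ (suc m) r₂ _) (cong (r₂ *_) (trans (sum1-neg (suc m) G) (cong -_ G-sum)))
  simplify : ∀ (v r₂ r₁ a t : ℚ) → v + r₂ * - - (r₁ * a) + t * 1ℚ ≡ v + t + r₂ * r₁ * a
  simplify = solve-∀ ℚ-ring

A-by-parts : ∀ (w : ℕ → ℚ) m →
  A w m ≡ ⟦ suc m ⟧ * recip (2 ℕ.+ m) * (w 1 + sum1 m (λ j → sgn j * (w (suc j) - w j) * recip (suc m C j)) + sgn m * w (suc m))
A-by-parts w m = begin
  w 1 + sum1 m (λ j → sgn j * h j * recip (m C j))
    ≡⟨ cong₂ _+_ (trans (sym (*-identityʳ (w 1))) (split-at (w 1) {0} z≤n))
                 (sum1-cong m (λ j j<m → split-at (sgn (suc j) * h (suc j)) j<m)) ⟩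
  c * (h 0 * (x 0 + x 1)) + sum1 m (λ j → c * (sgn j * h j * (x j + x (suc j))))
    ≡⟨ trans (cong (λ y → c * (h 0 * (x 0 + x 1)) + y) (sum1-*ˡ m c _)) (sym (*-distribˡ-+ c _ _)) ⟩
  c * (h 0 * (x 0 + x 1) + sum1 m (λ j → sgn j * h j * (x j + x (suc j))))
    ≡⟨ cong (c *_) (alternating-summation-by-parts h x m) ⟩
  c * (h 0 * x 0 + sum1 m (λ j → sgn j * (h j - h (j ∸ 1)) * x j) + sgn m * h m * x (suc m))
    ≡⟨ cong₂ (λ y z → c * (w 1 * 1ℚ + y + sgn m * h m * recip z)) (sum1-cong m (λ _ _ → refl)) (nCn≡1 (suc m)) ⟩
  c * (w 1 * 1ℚ + D + sgn m * w (suc m) * 1ℚ)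
    ≡⟨ cong (c *_) (drop-ones (w 1) D (sgn m * w (suc m))) ⟩
  c * (w 1 + D + sgn m * w (suc m)) ∎
  where
  c = ⟦ suc m ⟧ * recip (2 ℕ.+ m)
  h x : ℕ → ℚ
  h j = w (suc j)
  x j = recip (suc m C j)
  D = sum1 m (λ j → sgn j * (w (suc j) - w j) * recip (suc m C j))
  split-at : ∀ a {j} → j ℕ.≤ m → a * recip (m C j) ≡ c * (a * (x j + x (suc j)))
  split-at a j≤m = trans (cong (a *_) (1/mCj≡[1+m]/[2+m]*[1/[1+m]Cj+1/[1+m]C[1+j]] j≤m)) (swap a c _)
    where
    swap : ∀ (a c y : ℚ) → a * (c * y) ≡ c * (a * y)
    swap = solve-∀ ℚ-ring
  drop-ones : ∀ (a d b : ℚ) → a * 1ℚ + d + b * 1ℚ ≡ a + d + b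
  drop-ones = solve-∀ ℚ-ring

A-const : ∀ m → recip (suc m) * A (λ _ → 1ℚ) m ≡ recip (2 ℕ.+ m) * (1ℚ + sgn m)
A-const m = begin
  r₁ * A (λ _ → 1ℚ) m                                  ≡⟨ cong (r₁ *_) (A-by-parts (λ _ → 1ℚ) m) ⟩
  r₁ * (⟦ suc m ⟧ * r₂ * (1ℚ + D + sgn m * 1ℚ))         ≡⟨ cong (λ d → r₁ * (⟦ suc m ⟧ * r₂ * (1ℚ + d + sgn m * 1ℚ))) D≡0 ⟩
  r₁ * (⟦ suc m ⟧ * r₂ * (1ℚ + 0ℚ + sgn m * 1ℚ))        ≡⟨ regroup r₁ ⟦ suc m ⟧ r₂ (sgn m) ⟩
  (r₁ * ⟦ suc m ⟧) * (r₂ * (1ℚ + sgn m))                ≡⟨ cong (_* (r₂ * (1ℚ + sgn m))) (recip-inverse (suc m)) ⟩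
  1ℚ * (r₂ * (1ℚ + sgn m))                              ≡⟨ *-identityˡ _ ⟩
  r₂ * (1ℚ + sgn m)                                     ∎
  where
  r₁ = recip (suc m)
  r₂ = recip (2 ℕ.+ m)
  D = sum1 m (λ j → sgn j * (1ℚ - 1ℚ) * recip (suc m C j))
  D≡0 : D ≡ 0ℚ
  D≡0 = begin
    D                                             ≡⟨ sum1-cong m (λ j _ → vanish (sgn (suc j)) (recip (suc m C suc j))) ⟩
    sum1 m (λ j → 0ℚ * recip (suc m C j))         ≡⟨ sum1-*ˡ m 0ℚ (λ j → recip (suc m C j)) ⟩
    0ℚ * sum1 m (λ j → recip (suc m C j))         ≡⟨ *-zeroˡ (sum1 m (λ j → recip (suc m C j))) ⟩
    0ℚ                                            ∎
    where
    vanish : ∀ (s x : ℚ) → s * (1ℚ - 1ℚ) * x ≡ 0ℚ * x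
    vanish = solve-∀ ℚ-ring
  regroup : ∀ (r₁ a r₂ s : ℚ) → r₁ * (a * r₂ * (1ℚ + 0ℚ + s * 1ℚ)) ≡ (r₁ * a) * (r₂ * (1ℚ + s))
  regroup = solve-∀ ℚ-ring

alternating-1/C-shifted : ∀ m → sum1 m (λ i → sgn i * recip (m C (i ∸ 1))) ≡ sgn m - A (λ _ → 1ℚ) m
alternating-1/C-shifted m = begin
  E                                     ≡⟨ add-sub E t ⟩
  E + t - t                             ≡⟨ cong (λ z → E + sgn (suc m) * recip z - t) (nCn≡1 m) ⟨
  sum1 (suc m) g - t                    ≡⟨ cong (_- t) (sum1-sucˡ m g) ⟩
  g 1 + sum1 m (λ j → g (suc j)) - t    ≡⟨ cong (λ z → g 1 + z - t) (trans (sum1-cong m (λ j _ → neg-out (sgn (suc j)) _)) (sum1-neg m _)) ⟩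
  g 1 + - S - t                         ≡⟨ simplify S (sgn m) ⟩
  sgn m - A (λ _ → 1ℚ) m                ∎
  where
  g : ℕ → ℚ
  g i = sgn i * recip (m C (i ∸ 1))
  E = sum1 m g
  S = sum1 m (λ j → sgn j * 1ℚ * recip (m C j))
  t = - sgn m * 1ℚ
  add-sub : ∀ (a b : ℚ) → a ≡ a + b - b
  add-sub = solve-∀ ℚ-ring
  neg-out : ∀ (s x : ℚ) → (- s) * x ≡ - (s * 1ℚ * x)
  neg-out = solve-∀ ℚ-ring
  simplify : ∀ (S s : ℚ) → (- 1ℚ) * 1ℚ + - S - (- s) * 1ℚ ≡ s - (1ℚ + S)
  simplify = solve-∀ ℚ-ring

A-H : ∀ m → recip (suc m) * A (λ k → H (k ∸ 1)) m
            ≡ recip (2 ℕ.+ m) * (sgn m * H m + recip (suc m) * (sgn m - A (λ _ → 1ℚ) m))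
A-H m = begin
  r₁ * A (λ k → H (k ∸ 1)) m                          ≡⟨ cong (r₁ *_) (A-by-parts (λ k → H (k ∸ 1)) m) ⟩
  r₁ * (⟦ suc m ⟧ * r₂ * (0ℚ + D + sgn m * H m))       ≡⟨ cong (λ d → r₁ * (⟦ suc m ⟧ * r₂ * (0ℚ + d + sgn m * H m))) D≡r₁E ⟩
  r₁ * (⟦ suc m ⟧ * r₂ * (0ℚ + r₁ * E + sgn m * H m))  ≡⟨ regroup r₁ ⟦ suc m ⟧ r₂ E (sgn m * H m) ⟩
  (r₁ * ⟦ suc m ⟧) * (r₂ * (sgn m * H m + r₁ * E))
    ≡⟨ cong₂ (λ a e → a * (r₂ * (sgn m * H m + r₁ * e))) (recip-inverse (suc m)) (alternating-1/C-shifted m) ⟩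
  1ℚ * (r₂ * (sgn m * H m + r₁ * (sgn m - A (λ _ → 1ℚ) m))) ≡⟨ *-identityˡ _ ⟩
  r₂ * (sgn m * H m + r₁ * (sgn m - A (λ _ → 1ℚ) m))   ∎
  where
  r₁ = recip (suc m)
  r₂ = recip (2 ℕ.+ m)
  D = sum1 m (λ j → sgn j * (H j - H (j ∸ 1)) * recip (suc m C j))
  E = sum1 m (λ i → sgn i * recip (m C (i ∸ 1)))
  pointwise : ∀ j → sgn (suc j) * (H (suc j) - H j) * recip (suc m C suc j) ≡ r₁ * (sgn (suc j) * recip (m C j))
  pointwise j = begin
    s * (H (suc j) - H j) * recip (suc m C suc j)          ≡⟨ cong (λ h → s * (h - H j) * recip (suc m C suc j)) (H-suc j) ⟩
    s * (H j + recip (suc j) - H j) * recip (suc m C suc j) ≡⟨ cancel s (H j) (recip (suc j)) _ ⟩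
    s * (recip (suc j) * recip (suc m C suc j))           ≡⟨ cong (s *_) (1/[1+k]*1/[1+m]C[1+k] m j) ⟩
    s * (r₁ * recip (m C j))                              ≡⟨ swap s r₁ _ ⟩
    r₁ * (s * recip (m C j))                              ∎
    where
    s = sgn (suc j)
    cancel : ∀ (s h r x : ℚ) → s * (h + r - h) * x ≡ s * (r * x)
    cancel = solve-∀ ℚ-ring
    swap : ∀ (a b c : ℚ) → a * (b * c) ≡ b * (a * c)
    swap = solve-∀ ℚ-ring
  D≡r₁E : D ≡ r₁ * E
  D≡r₁E = trans (sum1-cong m (λ j _ → pointwise j)) (sum1-*ˡ m r₁ _)
  regroup : ∀ (r₁ a r₂ e h : ℚ) → r₁ * (a * r₂ * (0ℚ + r₁ * e + h)) ≡ (r₁ * a) * (r₂ * (h + r₁ * e))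
  regroup = solve-∀ ℚ-ring

V-const-suc : ∀ n → V (λ _ → 1ℚ) (suc n) ≡ V (λ _ → 1ℚ) n + recip (suc n) * recip (suc n) * (1ℚ - ⟦ 2 ⟧ * sgn n)
V-const-suc zero    = refl
V-const-suc (suc m) = begin
  V (λ _ → 1ℚ) (2 ℕ.+ m)
    ≡⟨ V-suc-suc (λ _ → 1ℚ) m ⟩
  V (λ _ → 1ℚ) (suc m) + t + r₂ * recip (suc m) * A (λ _ → 1ℚ) m
    ≡⟨ cong (λ x → V (λ _ → 1ℚ) (suc m) + t + x) (trans (*-assoc r₂ _ _) (cong (r₂ *_) (A-const m))) ⟩
  V (λ _ → 1ℚ) (suc m) + t + r₂ * (r₂ * (1ℚ + sgn m))
    ≡⟨ collect (V (λ _ → 1ℚ) (suc m)) (sgn m) r₂ ⟩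
  V (λ _ → 1ℚ) (suc m) + r₂ * r₂ * (1ℚ - ⟦ 2 ⟧ * sgn (suc m)) ∎
  where
  r₂ = recip (2 ℕ.+ m)
  t = sgn (2 ℕ.+ m) * 1ℚ * (r₂ * r₂)
  collect : ∀ (v s r : ℚ) → v + (- - s) * 1ℚ * (r * r) + r * (r * (1ℚ + s)) ≡ v + r * r * (1ℚ - ⟦ 2 ⟧ * (- s))
  collect = solve-∀ ℚ-ring

V-H-suc : ∀ n → V (λ k → H (k ∸ 1)) (suc n)
                ≡ V (λ k → H (k ∸ 1)) n - recip (suc n) * recip (suc n) * (⟦ 2 ⟧ * sgn n * H n + (1ℚ - sgn n) * recip (suc n))
V-H-suc zero    = refl
V-H-suc (suc m) = begin
  V Hₚ (2 ℕ.+ m)                                               ≡⟨ V-suc-suc Hₚ m ⟩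
  V Hₚ (suc m) + t + r₂ * r₁ * A Hₚ m                          ≡⟨ cong (λ x → V Hₚ (suc m) + t + x) (trans (*-assoc r₂ r₁ _) (cong (r₂ *_) (A-H m))) ⟩
  V Hₚ (suc m) + t + r₂ * (r₂ * (sgn m * H m + r₁ * (sgn m - A (λ _ → 1ℚ) m)))
                                                               ≡⟨ cong (λ x → V Hₚ (suc m) + t + x) (expand r₂ (sgn m * H m) r₁ (sgn m) _) ⟩
  V Hₚ (suc m) + t + r₂ * (r₂ * (sgn m * H m + r₁ * sgn m - r₁ * A (λ _ → 1ℚ) m))
                                                               ≡⟨ cong (λ x → V Hₚ (suc m) + t + r₂ * (r₂ * (sgn m * H m + r₁ * sgn m - x))) (A-const m) ⟩
  V Hₚ (suc m) + t + r₂ * (r₂ * (sgn m * H m + r₁ * sgn m - r₂ * (1ℚ + sgn m)))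
                                                               ≡⟨ collect (V Hₚ (suc m)) (sgn m) (H m) (H (suc m)) r₁ r₂ (H-suc m) ⟩
  V Hₚ (suc m) - r₂ * r₂ * (⟦ 2 ⟧ * sgn (suc m) * H (suc m) + (1ℚ - sgn (suc m)) * r₂) ∎
  where
  Hₚ : ℕ → ℚ
  Hₚ k = H (k ∸ 1)
  r₁ = recip (suc m)
  r₂ = recip (2 ℕ.+ m)
  t = sgn (2 ℕ.+ m) * H (suc m) * (r₂ * r₂)
  expand : ∀ (r₂ x r₁ s a : ℚ) → r₂ * (r₂ * (x + r₁ * (s - a))) ≡ r₂ * (r₂ * (x + r₁ * s - r₁ * a))
  expand = solve-∀ ℚ-ring
  collect : ∀ (v s h h₁ r₁ r₂ : ℚ) → h₁ ≡ h + r₁ →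
            v + (- - s) * h₁ * (r₂ * r₂) + r₂ * (r₂ * (s * h + r₁ * s - r₂ * (1ℚ + s)))
            ≡ v - r₂ * r₂ * (⟦ 2 ⟧ * (- s) * h₁ + (1ℚ - (- s)) * r₂)
  collect v s h _ r₁ r₂ refl = expanded v s h r₁ r₂
    where
    expanded : ∀ (v s h r₁ r₂ : ℚ) →
           v + (- - s) * (h + r₁) * (r₂ * r₂) + r₂ * (r₂ * (s * h + r₁ * s - r₂ * (1ℚ + s)))
           ≡ v - r₂ * r₂ * (⟦ 2 ⟧ * (- s) * (h + r₁) + (1ℚ - (- s)) * r₂)
    expanded = solve-∀ ℚ-ring

T-H : ∀ n → T H n ≡ H n * H n + V (λ _ → 1ℚ) n
T-H zero    = refl
T-H (suc n) = begin
  T H (suc n)                                           ≡⟨ T-suc H n ⟩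
  T (λ m → H (suc m)) n + r * (H (suc n) - Δ H (suc n))  ≡⟨ cong₂ (λ x y → x + r * (H (suc n) - y)) shifted (Δ-H n) ⟩
  T H n + r * (H (suc n) - sgn n * r * 1ℚ) + r * (H (suc n) - sgn n * r)
                                                        ≡⟨ cong (λ x → x + r * (H (suc n) - sgn n * r * 1ℚ) + r * (H (suc n) - sgn n * r)) (T-H n) ⟩
  H n * H n + V (λ _ → 1ℚ) n + r * (H (suc n) - sgn n * r * 1ℚ) + r * (H (suc n) - sgn n * r)
                                                        ≡⟨ collect (H n) (H (suc n)) _ _ (sgn n) r (H-suc n) (V-const-suc n) ⟩
  H (suc n) * H (suc n) + V (λ _ → 1ℚ) (suc n)           ∎
  where
  r = recip (suc n)
  shifted : T (λ m → H (suc m)) n ≡ T H n + r * (H (suc n) - sgn n * r * 1ℚ)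
  shifted = begin
    T (λ m → H (suc m)) n                               ≡⟨ conv-cong n (T-coeff n) H-suc ⟩
    T (λ m → H m + recip (suc m)) n                     ≡⟨ conv-+ n (T-coeff n) H (λ m → recip (suc m)) ⟩
    T H n + T (λ m → recip (suc m)) n                   ≡⟨ cong (λ x → T H n + x) (conv-cong n (T-coeff n) (λ m → sym (*-identityʳ (recip (suc m))))) ⟩
    T H n + T (λ m → recip (suc m) * 1ℚ) n              ≡⟨ cong (λ x → T H n + x) (T-recip-suc (λ _ → 1ℚ) n) ⟩
    T H n + r * (T (λ _ → 1ℚ) (suc n) - sgn n * r * 1ℚ) ≡⟨ cong (λ x → T H n + r * (x - sgn n * r * 1ℚ)) (T-const (suc n)) ⟩
    T H n + r * (H (suc n) - sgn n * r * 1ℚ)            ∎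
  collect : ∀ (h h₁ q q₁ s r : ℚ) → h₁ ≡ h + r → q₁ ≡ q + r * r * (1ℚ - ⟦ 2 ⟧ * s) →
            h * h + q + r * (h₁ - s * r * 1ℚ) + r * (h₁ - s * r) ≡ h₁ * h₁ + q₁
  collect h _ q _ s r refl refl = expanded h q s r
    where
    expanded : ∀ (h q s r : ℚ) → h * h + q + r * ((h + r) - s * r * 1ℚ) + r * ((h + r) - s * r)
                                 ≡ (h + r) * (h + r) + (q + r * r * (1ℚ - ⟦ 2 ⟧ * s))
    expanded = solve-∀ ℚ-ring

T-H²+H^2 : ∀ n → T H²+H^2 n ≡ H n * H n * H n + H n * H^ 2 n
                              + ⟦ 2 ⟧ * (H n * V (λ _ → 1ℚ) n - V (λ k → H (k ∸ 1)) n)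
T-H²+H^2 zero    = refl
T-H²+H^2 (suc n) = begin
  T H²+H^2 (suc n)
    ≡⟨ T-H²+H^2-suc n ⟩
  T H²+H^2 n + r * (⟦ 2 ⟧ * T H (suc n) + H²+H^2 (suc n) - ⟦ 2 ⟧ * sgn n * r * r)
    ≡⟨ cong₂ (λ x y → x + r * (⟦ 2 ⟧ * y + H²+H^2 (suc n) - ⟦ 2 ⟧ * sgn n * r * r)) (T-H²+H^2 n) (T-H (suc n)) ⟩
  H n * H n * H n + H n * H^ 2 n + ⟦ 2 ⟧ * (H n * V₁ n - Vₕ n)
    + r * (⟦ 2 ⟧ * (H (suc n) * H (suc n) + V₁ (suc n)) + H²+H^2 (suc n) - ⟦ 2 ⟧ * sgn n * r * r)
    ≡⟨ collect (H n) (H (suc n)) (H^ 2 n) (H^ 2 (suc n)) (V₁ n) (V₁ (suc n)) (Vₕ n) (Vₕ (suc n)) (sgn n) r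
               (H-suc n) (H²-suc n) (V-const-suc n) (V-H-suc n) ⟩
  H (suc n) * H (suc n) * H (suc n) + H (suc n) * H^ 2 (suc n) + ⟦ 2 ⟧ * (H (suc n) * V₁ (suc n) - Vₕ (suc n)) ∎
  where
  r = recip (suc n)
  V₁ Vₕ : ℕ → ℚ
  V₁ = V (λ _ → 1ℚ)
  Vₕ = V (λ k → H (k ∸ 1))
  collect : ∀ (h h₁ h₂ h₂' q q' w w' s r : ℚ) →
            h₁ ≡ h + r → h₂' ≡ h₂ + r * r → q' ≡ q + r * r * (1ℚ - ⟦ 2 ⟧ * s) →
            w' ≡ w - r * r * (⟦ 2 ⟧ * s * h + (1ℚ - s) * r) →
            h * h * h + h * h₂ + ⟦ 2 ⟧ * (h * q - w) + r * (⟦ 2 ⟧ * (h₁ * h₁ + q') + (h₁ * h₁ + h₂') - ⟦ 2 ⟧ * s * r * r)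
            ≡ h₁ * h₁ * h₁ + h₁ * h₂' + ⟦ 2 ⟧ * (h₁ * q' - w')
  collect h _ h₂ _ q _ w _ s r refl refl refl refl = expanded h h₂ q w s r
    where
    expanded : ∀ (h h₂ q w s r : ℚ) →
      h * h * h + h * h₂ + ⟦ 2 ⟧ * (h * q - w)
        + r * (⟦ 2 ⟧ * ((h + r) * (h + r) + (q + r * r * (1ℚ - ⟦ 2 ⟧ * s))) + ((h + r) * (h + r) + (h₂ + r * r)) - ⟦ 2 ⟧ * s * r * r)
      ≡ (h + r) * (h + r) * (h + r) + (h + r) * (h₂ + r * r)
        + ⟦ 2 ⟧ * ((h + r) * (q + r * r * (1ℚ - ⟦ 2 ⟧ * s)) - (w - r * r * (⟦ 2 ⟧ * s * h + (1ℚ - s) * r)))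
    expanded = solve-∀ ℚ-ring

invK2Binom≡ : ∀ n k → invK2Binom n k ≡ recip k * recip k * recip (n C k)
invK2Binom≡ n k = trans (as-recip n k) (trans (recip-* (k ℕ.* k) (n C k)) (cong (_* recip (n C k)) (recip-* k k)))
  where
  as-recip : ∀ n k → invK2Binom n k ≡ recip (k ℕ.* k ℕ.* (n C k))
  as-recip n k with k ℕ.* k ℕ.* (n C k)
  ... | zero  = refl
  ... | suc _ = refl

H-difference-sum : ∀ n → sum1 n (λ k → sgn k * (H n - H (k ∸ 1)) * invK2Binom n k)
                         ≡ H n * V (λ _ → 1ℚ) n - V (λ k → H (k ∸ 1)) n
H-difference-sum n = begin
  sum1 n (λ k → sgn k * (H n - H (k ∸ 1)) * invK2Binom n k)  ≡⟨ sum1-cong n (λ k _ → split (suc k)) ⟩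
  sum1 n (λ k → H n * v₁ k + - vₕ k)                          ≡⟨ sum1-+ n _ _ ⟩
  sum1 n (λ k → H n * v₁ k) + sum1 n (λ k → - vₕ k)           ≡⟨ cong₂ _+_ (sum1-*ˡ n (H n) v₁) (sum1-neg n vₕ) ⟩
  H n * V (λ _ → 1ℚ) n - V (λ k → H (k ∸ 1)) n                ∎
  where
  v₁ vₕ : ℕ → ℚ
  v₁ k = sgn k * 1ℚ * (recip k * recip k) * recip (n C k)
  vₕ k = sgn k * H (k ∸ 1) * (recip k * recip k) * recip (n C k)
  distribute : ∀ (s h x a c : ℚ) → s * (h - x) * (a * c) ≡ h * (s * 1ℚ * a * c) + - (s * x * a * c)
  distribute = solve-∀ ℚ-ring
  split : ∀ k → sgn k * (H n - H (k ∸ 1)) * invK2Binom n k ≡ H n * v₁ k + - vₕ k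
  split k = trans (cong (sgn k * (H n - H (k ∸ 1)) *_) (invK2Binom≡ n k))
                  (distribute (sgn k) (H n) (H (k ∸ 1)) (recip k * recip k) (recip (n C k)))

mainTheorem16 : (n : ℕ) →
    sum1 n (λ k → sgn (k ∸ 1) * invPowSuc 1 (k ∸ 1) * binomℚ n k
                   * (H (n ∸ k) * H (n ∸ k) + H^ 2 (n ∸ k)))
    ≡ H n * H n * H n + H n * H^ 2 n
      + (+ 2 / 1) * sum1 n (λ k → sgn k * (H n - H (k ∸ 1)) * invK2Binom n k)
mainTheorem16 n = begin
  sum1 n (λ k → sgn (k ∸ 1) * invPowSuc 1 (k ∸ 1) * binomℚ n k * H²+H^2 (n ∸ k))
    ≡⟨ sum1-cong n (λ k _ → cong (λ x → sgn k * x * ⟦ n C suc k ⟧ * H²+H^2 (n ∸ suc k)) (invPowSuc-1 k)) ⟩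
  T H²+H^2 n
    ≡⟨ T-H²+H^2 n ⟩
  H n * H n * H n + H n * H^ 2 n + ⟦ 2 ⟧ * (H n * V (λ _ → 1ℚ) n - V (λ k → H (k ∸ 1)) n)
    ≡⟨ cong (λ x → H n * H n * H n + H n * H^ 2 n + ⟦ 2 ⟧ * x) (H-difference-sum n) ⟨
  H n * H n * H n + H n * H^ 2 n + ⟦ 2 ⟧ * sum1 n (λ k → sgn k * (H n - H (k ∸ 1)) * invK2Binom n k) ∎
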